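{- Let $p$ be a positive integer, let $T$ be a tree with at least $p$ vertices, and let $H$ be a connected graph with at least $2p$ vertices. Let $V\subseteq V(T(H))$ with $OC(T,V)=V(T)$, and let $V_1,V_2$ be a partition of $V$ such that $|V_i|\le |V(T(H))|-p^2$ for each $i\in\{1,2\}$. Then $T(H)$ has a matching of size $p$ in which the two ends of each edge have different roles with respect to $V_1,V_2$.
   Context: For a tree $T$ and a graph $H$ with $V(H)=\{1,\dots,m\}$, $T(H)$ is the disjoint union of copies $H^w$ ($w\in V(T)$) of $H$, with $w^i$ the copy of $i$ in $H^w$, plus the edges $\{w^i,z^i\}$ for every $i$ and every edge $\{w,z\}$ of $T$. For $V\subseteq V(T(H))$, $OC(T,V)$ is the set of $w\in V(T)$ with $V(H^w)\cap V\neq\emptyset$. With respect to a partition $V_1,V_2$ of $V$, each vertex of $T(H)$ has one of three roles: in $V_1$, in $V_2$, or in $V(T(H))\setminus V$. -}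

module Defs where

open import Data.Nat using (ℕ; zero; suc; _+_; _*_)
open import Data.Fin using (Fin; zero; suc; inject₁; fromℕ)
open import Data.Product using (_×_; _,_; Σ; ∃)
open import Data.Sum using (_⊎_)
open import Relation.Binary.PropositionalEquality using (_≡_; _≢_)
open import Relation.Nullary using (¬_)
open import Relation.Binary.Construct.Closure.ReflexiveTransitive using (Star)
open import Function.Definitions using (Injective)
open import Level using (0ℓ)

record Graph (n : ℕ) : Set₁ where
  field
    Adj    : Fin n → Fin n → Set
    sym    : ∀ {u v} → Adj u v → Adj v u
    irrefl : ∀ {u} → ¬ Adj u u
open Graph public

Connected : ∀ {n} → Graph n → Set
Connected {n} G = (u v : Fin n) → Star (Adj G) u v

-- a cycle of length k+3: distinct vertices c 0, …, c (k+2),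
-- consecutive ones adjacent, and the last adjacent to the first
record Cycle {n : ℕ} (G : Graph n) : Set where
  field
    k      : ℕ
    c      : Fin (suc (suc (suc k))) → Fin n
    inj    : Injective _≡_ _≡_ c
    step   : (i : Fin (suc (suc k))) → Adj G (c (inject₁ i)) (c (suc i))
    close  : Adj G (c (fromℕ (suc (suc k)))) (c zero)

Acyclic : ∀ {n} → Graph n → Set
Acyclic G = ¬ Cycle G

IsTree : ∀ {n} → Graph n → Set
IsTree G = Connected G × Acyclic G

-- vertices of T(H): pairs (w , i) standing for w^i
VertexTH : ℕ → ℕ → Set
VertexTH t m = Fin t × Fin m

AdjTH : ∀ {t m} → Graph t → Graph m → VertexTH t m → VertexTH t m → Set
AdjTH T H (w , i) (z , j) = (w ≡ z × Adj H i j) ⊎ (i ≡ j × Adj T w z)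

-- the three roles with respect to a partition V₁ , V₂ of V
data Role : Set where
  inV₁ inV₂ outV : Role

open import Data.Bool using (Bool; true; false; if_then_else_)
countFin : ∀ {n} → (Fin n → Bool) → ℕ
countFin {zero}  f = 0
countFin {suc n} f = (if f zero then 1 else 0) + countFin (λ i → f (suc i))

isRole : Role → Role → Bool
isRole inV₁ inV₁ = true
isRole inV₂ inV₂ = true
isRole outV outV = true
isRole _    _    = false

countRole : ∀ {t m} → (VertexTH t m → Role) → Role → ℕ
countRole {t} {m} ρ r =
  sumFin (λ w → countFin (λ i → isRole (ρ (w , i)) r))
  where
  sumFin : ∀ {k} → (Fin k → ℕ) → ℕ
  sumFin {zero} g = 0
  sumFin {suc k} g = g zero + sumFin (λ w → g (suc w))

record RoleMatching {t m} (T : Graph t) (H : Graph m)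
                    (ρ : VertexTH t m → Role) (p : ℕ) : Set where
  field
    left right : Fin p → VertexTH t m
    isEdge     : (e : Fin p) → AdjTH T H (left e) (right e)
    disjoint   : (e f : Fin p) → e ≢ f →
                 (left e ≢ left f) × (left e ≢ right f) ×
                 (right e ≢ left f) × (right e ≢ right f)
    diffRole   : (e : Fin p) → ρ (left e) ≢ ρ (right e)

module Submission where

-- Think of T(H) as a t × m grid: the row of w ∈ V(T) is the
-- copy H^w, the column of i ∈ V(H) is the copy of T formed by the vertices
-- w^i.  Call a row or column *mixed* if its vertices do not all have the
-- same role.
--   * If p rows are mixed, then in each of them a walk in H between two
--     vertices of different roles contains an edge whose ends have different
--     roles; edges in distinct rows are disjoint, giving the matching.
--   * Symmetrically (transpose the grid) if p columns are mixed.
--   * Otherwise, as p ≤ t and p ≤ m, some row w₀ and some column i₀ are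
--     monochromatic, both with the role c of w₀^i₀.  Every vertex of role
--     other than c then lies in a mixed row and a mixed column, so fewer
--     than p² vertices have a role other than c.  The hypotheses on |V₁|,
--     |V₂| exclude c = inV₁, inV₂, and OC(T,V) = V(T) excludes c = outV,
--     since row w₀ would avoid V.

open import Defs
open import Data.Nat using (ℕ; _+_; _*_; _≤_)
open import Data.Fin using (Fin)
open import Data.Product using (Σ; _,_)
open import Relation.Binary.PropositionalEquality using (_≢_)

open import Data.Nat using (zero; suc; _<_; z≤n; s≤s; _≤?_)
open import Data.Nat.Properties
  using (≤-trans; ≤-reflexive; +-suc; +-monoʳ-≤; m≤n+m; ≤-pred; +-mono-≤; m≤m+n;
         <-≤-trans; *-mono-<; <⇒≱; ≰⇒>; +-cancelˡ-≤; +-commutativeSemigroup)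
open import Data.Fin using (zero; suc)
open import Data.Fin.Properties using (any?; suc-injective)
open import Data.Product using (∃; _×_; proj₁; proj₂; swap)
open import Data.Sum using (inj₁)
import Data.Sum as Sum
open import Data.Bool using (Bool; true; false)
open import Data.Bool.Properties using (¬-not)
open import Data.Empty using (⊥; ⊥-elim)
open import Function.Definitions using (Injective)
open import Relation.Nullary using (yes; no; does; ¬?)
open import Relation.Nullary.Decidable using (decidable-stable)
open import Relation.Binary.Definitions using (DecidableEquality)
open import Relation.Binary.PropositionalEquality using (_≡_; refl; trans; cong; subst)
  renaming (sym to ≡-sym)
open import Relation.Binary.Construct.Closure.ReflexiveTransitive using (Star; ε; _◅_)
open import Algebra.Properties.CommutativeSemigroup +-commutativeSemigroup using (interchange)

_≟ᴿ_ : DecidableEquality Role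
inV₁ ≟ᴿ inV₁ = yes refl
inV₂ ≟ᴿ inV₂ = yes refl
outV ≟ᴿ outV = yes refl
inV₁ ≟ᴿ inV₂ = no λ ()
inV₁ ≟ᴿ outV = no λ ()
inV₂ ≟ᴿ inV₁ = no λ ()
inV₂ ≟ᴿ outV = no λ ()
outV ≟ᴿ inV₁ = no λ ()
outV ≟ᴿ inV₂ = no λ ()

isRole-refl : ∀ r → isRole r r ≡ true
isRole-refl inV₁ = refl
isRole-refl inV₂ = refl
isRole-refl outV = refl

isRole-false : ∀ {r s} → isRole r s ≡ false → r ≢ s
isRole-false {r} eq refl with () ← trans (≡-sym (isRole-refl r)) eq

countFin-cover : ∀ {n} (f g : Fin n → Bool) → (∀ i → f i ≡ false → g i ≡ true) →
                 n ≤ countFin f + countFin g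
countFin-cover {zero}  f g cover = z≤n
countFin-cover {suc n} f g cover with f zero in ef
... | true  = s≤s (≤-trans (countFin-cover f′ g′ (λ i → cover (suc i)))
                           (+-monoʳ-≤ (countFin f′) (m≤n+m (countFin g′) _)))
  where
  f′ g′ : Fin n → Bool
  f′ i = f (suc i)
  g′ i = g (suc i)
... | false with g zero in eg
...   | true  = ≤-trans (s≤s (countFin-cover _ _ (λ i → cover (suc i))))
                        (≤-reflexive (≡-sym (+-suc _ _)))
...   | false with () ← trans (≡-sym eg) (cover zero ef)

countFin-none : ∀ n → countFin {n} (λ _ → false) ≡ 0
countFin-none zero    = refl
countFin-none (suc n) = countFin-none n

countFin-miss : ∀ {n} (f : Fin n → Bool) → countFin f < n → ∃ λ i → f i ≡ false
countFin-miss {suc n} f lt with f zero in ef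
... | false = zero , ef
... | true  with countFin-miss (λ i → f (suc i)) (≤-pred lt)
...   | i , fi = suc i , fi

countFin-select : ∀ {n} (f : Fin n → Bool) p → p ≤ countFin f →
                  Σ (Fin p → Fin n) λ g → (∀ k → f (g k) ≡ true) × Injective _≡_ _≡_ g
countFin-select f zero _ = (λ ()) , (λ ()) , λ {}
countFin-select {suc n} f (suc p) le with f zero in ef
... | false with countFin-select (λ i → f (suc i)) (suc p) le
...   | g , sat , inj = (λ k → suc (g k)) , sat , λ eq → inj (suc-injective eq)
countFin-select {suc n} f (suc p) le | true
    with countFin-select (λ i → f (suc i)) p (≤-pred le)
...   | g , sat , inj = extend , extend-sat , extend-inj
  where
  extend : Fin (suc p) → Fin (suc n)
  extend zero    = zero
  extend (suc k) = suc (g k)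
  extend-sat : ∀ k → f (extend k) ≡ true
  extend-sat zero    = ef
  extend-sat (suc k) = sat k
  extend-inj : Injective _≡_ _≡_ extend
  extend-inj {zero}  {zero}  _  = refl
  extend-inj {suc _} {suc _} eq = cong suc (inj (suc-injective eq))
  extend-inj {zero}  {suc _} ()
  extend-inj {suc _} {zero}  ()

Mixed : ∀ {n} → (Fin n → Role) → Set
Mixed h = ∃ λ i → ∃ λ j → h i ≢ h j

Monochromatic : ∀ {n} → (Fin n → Role) → Set
Monochromatic h = ∀ i j → h i ≡ h j

isMixed : ∀ {n} → (Fin n → Role) → Bool
isMixed h = does (any? λ i → any? λ j → ¬? (h i ≟ᴿ h j))

isMixed-true : ∀ {n} (h : Fin n → Role) → isMixed h ≡ true → Mixed h
isMixed-true h eq with any? (λ i → any? λ j → ¬? (h i ≟ᴿ h j)) | eq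
... | yes mixed | _ = mixed

isMixed-false : ∀ {n} (h : Fin n → Role) → isMixed h ≡ false → Monochromatic h
isMixed-false h eq with any? (λ i → any? λ j → ¬? (h i ≟ᴿ h j)) | eq
... | no unmixed | _ = λ i j → decidable-stable (h i ≟ᴿ h j) λ ne → unmixed (i , j , ne)

someMonochromatic : ∀ {n k} (h : Fin n → Fin k → Role) →
                    countFin (λ w → isMixed (h w)) < n → ∃ λ w → Monochromatic (h w)
someMonochromatic h few with countFin-miss (λ w → isMixed (h w)) few
... | w , unmixed = w , isMixed-false (h w) unmixed

row : ∀ {t m} → (VertexTH t m → Role) → Fin t → Fin m → Role
row ρ w i = ρ (w , i)

column : ∀ {t m} → (VertexTH t m → Role) → Fin m → Fin t → Role
column ρ i w = ρ (w , i)

mixedRows : ∀ {t m} → (VertexTH t m → Role) → Fin t → Bool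
mixedRows ρ w = isMixed (row ρ w)

mixedColumns : ∀ {t m} → (VertexTH t m → Role) → Fin m → Bool
mixedColumns ρ i = isMixed (column ρ i)

transpose : ∀ {t m} → (VertexTH t m → Role) → VertexTH m t → Role
transpose ρ v = ρ (swap v)

bichromaticStep : ∀ {A C : Set} → DecidableEquality C → (R : A → A → Set) (f : A → C) →
                  ∀ {u v} → Star R u v → f u ≢ f v →
                  ∃ λ a → ∃ λ b → R a b × f a ≢ f b
bichromaticStep _≟_ R f ε ne = ⊥-elim (ne refl)
bichromaticStep _≟_ R f {u} (_◅_ {j = y} uy walk) ne with f u ≟ f y
... | yes same = bichromaticStep _≟_ R f walk λ eq → ne (trans same eq)
... | no  diff = u , y , uy , diff

mixedEdge : ∀ {m} (H : Graph m) → Connected H → (h : Fin m → Role) → Mixed h →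
            ∃ λ a → ∃ λ b → Adj H a b × h a ≢ h b
mixedEdge H connH h (i , j , ne) = bichromaticStep _≟ᴿ_ (Adj H) h (connH i j) ne

rowMatching : ∀ {t m p} (T : Graph t) (H : Graph m) → Connected H →
              (ρ : VertexTH t m → Role) → p ≤ countFin (mixedRows ρ) →
              RoleMatching T H ρ p
rowMatching {p = p} T H connH ρ many = record
  { left     = λ e → g e , proj₁ (edge e)
  ; right    = λ e → g e , proj₁ (proj₂ (edge e))
  ; isEdge   = λ e → inj₁ (refl , proj₁ (proj₂ (proj₂ (edge e))))
  ; disjoint = λ e f e≢f → rowsApart e≢f , rowsApart e≢f , rowsApart e≢f , rowsApart e≢f
  ; diffRole = λ e → proj₂ (proj₂ (proj₂ (edge e)))
  }
  where
  chosen = countFin-select (mixedRows ρ) p many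
  g = proj₁ chosen
  edge : ∀ e → ∃ λ a → ∃ λ b → Adj H a b × row ρ (g e) a ≢ row ρ (g e) b
  edge e = mixedEdge H connH (row ρ (g e)) (isMixed-true _ (proj₁ (proj₂ chosen) e))
  rowsApart : ∀ {e f} {a b : Fin _} → e ≢ f → (g e , a) ≢ (g f , b)
  rowsApart e≢f eq = e≢f (proj₂ (proj₂ chosen) (cong proj₁ eq))

transposeMatching : ∀ {t m p} (T : Graph t) (H : Graph m) (ρ : VertexTH t m → Role) →
                    RoleMatching H T (transpose ρ) p → RoleMatching T H ρ p
transposeMatching T H ρ M = record
  { left     = λ e → swap (left e)
  ; right    = λ e → swap (right e)
  ; isEdge   = λ e → Sum.swap (isEdge e)
  ; disjoint = λ e f e≢f → let (n₁ , n₂ , n₃ , n₄) = disjoint e f e≢f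
                           in swap-≢ n₁ , swap-≢ n₂ , swap-≢ n₃ , swap-≢ n₄
  ; diffRole = diffRole
  }
  where
  open RoleMatching M
  swap-≢ : ∀ {x y : VertexTH _ _} → x ≢ y → swap x ≢ swap y
  swap-≢ x≢y eq = x≢y (cong swap eq)

columnMatching : ∀ {t m p} (T : Graph t) (H : Graph m) → Connected T →
                 (ρ : VertexTH t m → Role) → p ≤ countFin (mixedColumns ρ) →
                 RoleMatching T H ρ p
columnMatching T H connT ρ many =
  transposeMatching T H ρ (rowMatching H T connT (transpose ρ) many)

addBounds : ∀ {m n a b c d} → m ≤ a + b → n ≤ c + d → m + n ≤ (a + c) + (b + d)
addBounds {a = a} {b} {c} {d} m≤ n≤ =
  ≤-trans (+-mono-≤ m≤ n≤) (≤-reflexive (interchange a b c d))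

dropRow : ∀ {t m} → (VertexTH (suc t) m → Role) → VertexTH t m → Role
dropRow ρ (w , i) = ρ (suc w , i)

countInRow : ∀ {t m} → (VertexTH t m → Role) → Role → Fin t → ℕ
countInRow ρ c w = countFin (λ i → isRole (ρ (w , i)) c)

-- The inductive step of coverBound: add the first row to the bound for the
-- others.  Here countRole ρ c unfolds definitionally to
-- countInRow ρ c zero + countRole (dropRow ρ) c.
coverFirstRow : ∀ {t m} (ρ : VertexTH (suc t) m → Role) (c : Role)
                (R : Fin (suc t) → Bool) (C : Fin m → Bool) →
                (∀ w i → ρ (w , i) ≢ c → R w ≡ true × C i ≡ true) →
                t * m ≤ countRole (dropRow ρ) c + countFin (λ w → R (suc w)) * countFin C →
                suc t * m ≤ countRole ρ c + countFin R * countFin C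
coverFirstRow {m = m} ρ c R C cover lowerRows with R zero in eR
... | true  = addBounds {a = countInRow ρ c zero} firstRow lowerRows
  where
  firstRow : m ≤ countInRow ρ c zero + countFin C
  firstRow = countFin-cover _ C λ i fi → proj₂ (cover zero i (isRole-false fi))
... | false = addBounds {a = countInRow ρ c zero} firstRow lowerRows
  where
  firstRow : m ≤ countInRow ρ c zero + 0
  firstRow = subst (m ≤_) (cong (countInRow ρ c zero +_) (countFin-none m))
    (countFin-cover _ (λ _ → false) λ i fi →
      trans (≡-sym eR) (proj₁ (cover zero i (isRole-false fi))))

coverBound : ∀ {t m} (ρ : VertexTH t m → Role) (c : Role) (R : Fin t → Bool) (C : Fin m → Bool) →
             (∀ w i → ρ (w , i) ≢ c → R w ≡ true × C i ≡ true) →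
             t * m ≤ countRole ρ c + countFin R * countFin C
coverBound {zero}  ρ c R C cover = z≤n
coverBound {suc t} ρ c R C cover =
  coverFirstRow ρ c R C cover
    (coverBound (dropRow ρ) c (λ w → R (suc w)) C (λ w → cover (suc w)))

monochromaticCross : ∀ {t m} (ρ : VertexTH t m → Role) {w₀ i₀} →
                     Monochromatic (row ρ w₀) → Monochromatic (column ρ i₀) →
                     ∀ w i → ρ (w , i) ≢ ρ (w₀ , i₀) →
                     mixedRows ρ w ≡ true × mixedColumns ρ i ≡ true
monochromaticCross ρ {w₀} {i₀} rowMono colMono w i ne =
  ¬-not (λ unmixed → ne (trans (isMixed-false _ unmixed i i₀) (colMono w w₀))) ,
  ¬-not (λ unmixed → ne (trans (isMixed-false _ unmixed w w₀) (rowMono i i₀)))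

dominantRole : ∀ {t m p} (ρ : VertexTH t m → Role) → p ≤ t → p ≤ m →
               countFin (mixedRows ρ) < p → countFin (mixedColumns ρ) < p →
               ∃ λ w₀ → ∃ λ i₀ → Monochromatic (row ρ w₀) ×
                 (countRole ρ (ρ (w₀ , i₀)) + p * p ≤ t * m → ⊥)
dominantRole {t} {m} {p} ρ p≤t p≤m fewRows fewCols = w₀ , i₀ , rowMono , tooMany
  where
  w₀,mono = someMonochromatic (row ρ) (<-≤-trans fewRows p≤t)
  i₀,mono = someMonochromatic (column ρ) (<-≤-trans fewCols p≤m)
  w₀ = proj₁ w₀,mono
  i₀ = proj₁ i₀,mono
  rowMono = proj₂ w₀,mono
  dense = coverBound ρ (ρ (w₀ , i₀)) (mixedRows ρ) (mixedColumns ρ)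
                     (monochromaticCross ρ rowMono (proj₂ i₀,mono))
  tooMany : countRole ρ (ρ (w₀ , i₀)) + p * p ≤ t * m → ⊥
  tooMany le = <⇒≱ (*-mono-< fewRows fewCols) (+-cancelˡ-≤ _ _ _ (≤-trans le dense))

lemma2 : (p t m : ℕ) → 1 ≤ p →
    (T : Graph t) → IsTree T → p ≤ t →
    (H : Graph m) → Connected H → 2 * p ≤ m →
    (ρ : VertexTH t m → Role) →
    ((w : Fin t) → Σ (Fin m) (λ i → ρ (w , i) ≢ outV)) →
    countRole ρ inV₁ + p * p ≤ t * m →
    countRole ρ inV₂ + p * p ≤ t * m →
    RoleMatching T H ρ p
lemma2 p t m _ T (connT , _) p≤t H connH 2p≤m ρ meetsV small₁ small₂
  with p ≤? countFin (mixedRows ρ) | p ≤? countFin (mixedColumns ρ)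
... | yes manyRows | _            = rowMatching T H connH ρ manyRows
... | no _         | yes manyCols = columnMatching T H connT ρ manyCols
... | no fewRows   | no fewCols
  with dominantRole ρ p≤t (≤-trans (m≤m+n p (p + 0)) 2p≤m) (≰⇒> fewRows) (≰⇒> fewCols)
...   | w₀ , i₀ , rowMono , tooMany = ⊥-elim (excluded (ρ (w₀ , i₀)) refl)
  where
  excluded : ∀ c → ρ (w₀ , i₀) ≡ c → ⊥
  excluded inV₁ eq = tooMany (subst (λ c → countRole ρ c + p * p ≤ t * m) (≡-sym eq) small₁)
  excluded inV₂ eq = tooMany (subst (λ c → countRole ρ c + p * p ≤ t * m) (≡-sym eq) small₂)
  excluded outV eq = proj₂ (meetsV w₀) (trans (rowMono _ i₀) eq)
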